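{- Let $N$ be a homogeneous network with asymmetric inputs and $\tilde{N}$ its fundamental network. If $N$ is transitive, then $\tilde{N}$ is a subnetwork of $N$ (up to isomorphism).
   Context: A homogeneous network with asymmetric inputs has a finite cell set $C$, one cell type, $k$ edge types, each cell receiving exactly one edge of each type; it is represented by $\sigma_1,\dots,\sigma_k:C\to C$ (type-$i$ edge into $c$ comes from $\sigma_i(c)$). A network fibration between such networks is (determined by) a cell map $\varphi$ with $\varphi\circ\sigma_i=\sigma'_i\circ\varphi$ for all $i$. $N$ is transitive for a cell $c$ if for every cell $d$ there is a network fibration $\phi_d:N\to N$ with $\phi_d(c)=d$; $N$ is transitive if transitive for some cell. $S$ is a subnetwork of $M$ if its cells form a subset of $M$'s cells such that every edge of $M$ targeting a cell of $S$ belongs to $S$ and has source in $S$; up to isomorphism this is equivalent to the existence of an injective network fibration $S\to M$. The fundamental network $\tilde{N}$ has as cells the semigroup $\tilde{C}$ of maps $C\to C$ generated under composition by $Id_C,\sigma_1,\dots,\sigma_k$, represented by $\tilde{\sigma}_i(\gamma)=\sigma_i\circ\gamma$. -}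

module Defs where

open import Data.Nat using (ℕ)
open import Data.Fin using (Fin)
open import Data.Product using (Σ; ∃; _×_; _,_; proj₁)
open import Function using (_∘_; id)
open import Relation.Binary.PropositionalEquality using (_≡_)

-- A homogeneous network with asymmetric inputs: n cells (Fin n), k edge types;
-- σ i c is the source of the type-i edge into cell c.
record Network (k : ℕ) : Set where
  field
    n : ℕ
    σ : Fin k → Fin n → Fin n
open Network public

Cell : ∀ {k} → Network k → Set
Cell N = Fin (n N)

IsFibration : ∀ {k} (N N' : Network k) → (Cell N → Cell N') → Set
IsFibration N N' φ = ∀ i c → φ (σ N i c) ≡ σ N' i (φ c)

TransitiveFor : ∀ {k} (N : Network k) → Cell N → Set
TransitiveFor N c =
  ∀ d → Σ (Cell N → Cell N) λ φ → IsFibration N N φ × φ c ≡ d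

Transitive : ∀ {k} → Network k → Set
Transitive N = ∃ λ c → TransitiveFor N c

data Generated {k : ℕ} (N : Network k) : (Cell N → Cell N) → Set where
  gen-id   : Generated N id
  gen-σ    : ∀ i → Generated N (σ N i)
  gen-comp : ∀ {γ δ} → Generated N γ → Generated N δ → Generated N (γ ∘ δ)

-- Cells of the fundamental network: generated maps (no funext, so equality of
-- cells is pointwise equality of the underlying maps, see _≈̃_).
FCell : ∀ {k} → Network k → Set
FCell N = Σ (Cell N → Cell N) (Generated N)

_≈̃_ : ∀ {k} {N : Network k} → FCell N → FCell N → Set
_≈̃_ {N = N} (γ , _) (δ , _) = ∀ (c : Cell N) → γ c ≡ δ c

σ̃ : ∀ {k} (N : Network k) → Fin k → FCell N → FCell N
σ̃ N i (γ , g) = (σ N i ∘ γ , gen-comp (gen-σ i) g)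

-- Ñ is a subnetwork of N up to isomorphism: there is an injective network
-- fibration Ñ → N (well defined on cells of Ñ, i.e. respecting ≈̃).
FundamentalIsSubnetwork : ∀ {k} → Network k → Set
FundamentalIsSubnetwork N =
  Σ (FCell N → Cell N) λ φ →
      (∀ γ δ → γ ≈̃ δ → φ γ ≡ φ δ)
    × (∀ i γ → φ (σ̃ N i γ) ≡ σ N i (φ γ))
    × (∀ γ δ → φ γ ≡ φ δ → γ ≈̃ δ)

-- Evaluation at the transitive cell c, γ ↦ γ c, is the embedding: it turns σ̃ᵢ into σᵢ
-- by definition, and it is injective because every generated map commutes with every
-- fibration N → N, so γ d = γ (φ_d c) = φ_d (γ c) is determined by γ c.
module Submission where

open import Defs
open import Data.Nat using (ℕ)
open import Data.Product using (_,_; proj₁)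
open import Relation.Binary.PropositionalEquality using (_≡_; refl; cong; sym; trans; module ≡-Reasoning)

module _ {k : ℕ} (N : Network k) where

  fibration-commutes-with-generated :
    ∀ {φ} → IsFibration N N φ → ∀ {γ} → Generated N γ → ∀ x → φ (γ x) ≡ γ (φ x)
  fibration-commutes-with-generated fib gen-id       x = refl
  fibration-commutes-with-generated fib (gen-σ i)    x = fib i x
  fibration-commutes-with-generated {φ} fib (gen-comp {γ} {δ} g h) x = begin
    φ (γ (δ x))  ≡⟨ fibration-commutes-with-generated fib g (δ x) ⟩
    γ (φ (δ x))  ≡⟨ cong γ (fibration-commutes-with-generated fib h x) ⟩
    γ (δ (φ x))  ∎
    where open ≡-Reasoning

  evalAt : Cell N → FCell N → Cell N
  evalAt c γ = proj₁ γ c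

  evalAt-injective : ∀ {c} → TransitiveFor N c →
                     ∀ γ δ → evalAt c γ ≡ evalAt c δ → γ ≈̃ δ
  evalAt-injective {c} tr (γ , g) (δ , h) γc≡δc d with tr d
  ... | φ , fib , refl = begin
    γ (φ c)  ≡⟨ sym (fibration-commutes-with-generated fib g c) ⟩
    φ (γ c)  ≡⟨ cong φ γc≡δc ⟩
    φ (δ c)  ≡⟨ fibration-commutes-with-generated fib h c ⟩
    δ (φ c)  ∎
    where open ≡-Reasoning

mainTheorem11 : ∀ {k : ℕ} (N : Network k) → Transitive N → FundamentalIsSubnetwork N
mainTheorem11 N (c , tr) =
    evalAt N c
  , (λ γ δ γ≈δ → γ≈δ c)
  , (λ i γ → refl)
  , evalAt-injective N tr
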